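{- Let $k\ge 2$ and $R=F_{q_1}\times\cdots\times F_{q_k}$, where $F_q$ denotes a finite field with $q$ elements. For a non-empty proper subset $A\subsetneq[k]$ let $X_A=\{(x_1,\dots,x_k)\in R: x_i\ne 0 \iff i\in A\}$, and let $x_A\in X_A$ be a representative. Let $\Upsilon'(R)$ be the subgraph of the cozero-divisor graph $\Gamma'(R)$ induced by the representatives $\{x_A\}$. Then for distinct non-empty proper subsets $A,B$ of $[k]$, \[ d_{\Upsilon'(R)}(x_A,x_B)=\begin{cases}1 & \text{if } A\not\subseteq B \text{ and } B\not\subseteq A,\\ 2 & \text{otherwise.}\end{cases} \]
   Context: The cozero-divisor graph $\Gamma'(R)$ of a ring $R$ with unity is the simple undirected graph whose vertices are the non-zero non-unit elements of $R$, with distinct vertices $x,y$ adjacent iff $x\notin Ry$ and $y\notin Rx$. $[k]=\{1,\dots,k\}$. The sets $X_A$ are exactly the classes of elements generating the same principal ideal. -}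

module Defs where

open import Level using (Level; _⊔_)
open import Algebra.Bundles using (CommutativeRing)
open import Algebra.Structures
open import Data.Nat using (ℕ; zero; suc; _≤_)
open import Data.Fin using (Fin)
open import Data.Fin.Subset using (Subset; _∈_; _⊂_; ⊤; Nonempty)
open import Data.Product using (Σ; ∃; _×_; _,_; proj₁)
open import Relation.Nullary using (¬_)
open import Relation.Binary.Structures using (IsEquivalence)

private
  variable
    c ℓ : Level

IsField : CommutativeRing c ℓ → Set (c ⊔ ℓ)
IsField R = (¬ (1# ≈ 0#)) × (∀ x → ¬ (x ≈ 0#) → ∃ λ y → (x * y) ≈ 1#)
  where open CommutativeRing R

IsFinite : CommutativeRing c ℓ → Set (c ⊔ ℓ)
IsFinite R = ∃ λ (q : ℕ) → Σ (Fin q → Carrier) λ f → ∀ x → ∃ λ i → f i ≈ x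
  where open CommutativeRing R

module _ {k : ℕ} (F : Fin k → CommutativeRing c ℓ) where
  private
    module F (i : Fin k) = CommutativeRing (F i)

  ΠCarrier : Set c
  ΠCarrier = (i : Fin k) → F.Carrier i

  Π-isCommutativeRing : IsCommutativeRing {A = ΠCarrier}
    (λ x y → ∀ i → F._≈_ i (x i) (y i))
    (λ x y i → F._+_ i (x i) (y i))
    (λ x y i → F._*_ i (x i) (y i))
    (λ x i → F.-_ i (x i))
    (λ i → F.0# i)
    (λ i → F.1# i)
  Π-isCommutativeRing = record
    { isRing = record
      { +-isAbelianGroup = record
        { isGroup = record
          { isMonoid = record
            { isSemigroup = record
              { isMagma = record
                { isEquivalence = record
                  { refl = λ i → F.refl i
                  ; sym = λ p i → F.sym i (p i)
                  ; trans = λ p q i → F.trans i (p i) (q i) }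
                ; ∙-cong = λ p q i → F.+-cong i (p i) (q i) }
              ; assoc = λ x y z i → F.+-assoc i (x i) (y i) (z i) }
            ; identity = (λ x i → F.+-identityˡ i (x i)) , (λ x i → F.+-identityʳ i (x i)) }
          ; inverse = (λ x i → F.-‿inverseˡ i (x i)) , (λ x i → F.-‿inverseʳ i (x i))
          ; ⁻¹-cong = λ p i → F.-‿cong i (p i) }
        ; comm = λ x y i → F.+-comm i (x i) (y i) }
      ; *-cong = λ p q i → F.*-cong i (p i) (q i)
      ; *-assoc = λ x y z i → F.*-assoc i (x i) (y i) (z i)
      ; *-identity = (λ x i → F.*-identityˡ i (x i)) , (λ x i → F.*-identityʳ i (x i))
      ; distrib = (λ x y z i → F.distribˡ i (x i) (y i) (z i)) , (λ x y z i → F.distribʳ i (x i) (y i) (z i)) }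
    ; *-comm = λ x y i → F.*-comm i (x i) (y i) }

  ΠRing : CommutativeRing c ℓ
  ΠRing = record { isCommutativeRing = Π-isCommutativeRing }

module _ (R : CommutativeRing c ℓ) where
  open CommutativeRing R

  _∈R·_ : Carrier → Carrier → Set (c ⊔ ℓ)
  x ∈R· y = ∃ λ r → x ≈ (r * y)

  IsUnit : Carrier → Set (c ⊔ ℓ)
  IsUnit x = ∃ λ y → (x * y) ≈ 1#

  IsVertex : Carrier → Set (c ⊔ ℓ)
  IsVertex x = (¬ (x ≈ 0#)) × (¬ IsUnit x)

  CozeroAdj : Carrier → Carrier → Set (c ⊔ ℓ)
  CozeroAdj x y = IsVertex x × IsVertex y × (¬ (x ≈ y)) × (¬ (x ∈R· y)) × (¬ (y ∈R· x))

data Walk {a b : Level} {V : Set a} (E : V → V → Set b) : V → V → ℕ → Set (a ⊔ b) where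
  [] : ∀ {v} → Walk E v v zero
  _∷_ : ∀ {u v w n} → E u v → Walk E v w n → Walk E u w (suc n)

Dist : {a b : Level} {V : Set a} (E : V → V → Set b) → V → V → ℕ → Set (a ⊔ b)
Dist E u v n = Walk E u v n × (∀ m → Walk E u v m → n ≤ m)

NEPSubset : ℕ → Set
NEPSubset k = Σ (Subset k) λ A → Nonempty A × (A ⊂ ⊤)

module _ {k : ℕ} (F : Fin k → CommutativeRing c ℓ) where
  private
    module F (i : Fin k) = CommutativeRing (F i)

  InX : Subset k → ΠCarrier F → Set ℓ
  InX A x = ∀ i → ((¬ F._≈_ i (x i) (F.0# i)) → i ∈ A) × (i ∈ A → ¬ F._≈_ i (x i) (F.0# i))

  -- Υ'(R): the subgraph of Γ'(R) induced by the representatives x_A,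
  -- with the vertex x_A indexed by A.
  UpsilonAdj : (NEPSubset k → ΠCarrier F) → NEPSubset k → NEPSubset k → Set (c ⊔ ℓ)
  UpsilonAdj rep A B = CozeroAdj (ΠRing F) (rep A) (rep B)

-- If i ∈ A ∖ B then x_A ∉ R x_B, since every
-- multiple of x_B vanishes at i; so incomparable A, B are adjacent. If A ⊆ B then, the factors
-- being fields, x_A = r x_B with r_i = (x_A)_i (x_B)_i⁻¹ on B and r_i = 0 off B; so comparable
-- A, B are not adjacent, and the complement of the smaller set is incomparable with both.
module Submission where

open import Defs
open import Level using (Level)
open import Algebra.Bundles using (CommutativeRing)
open import Data.Nat using (ℕ; _≤_; zero; suc; s≤s; z≤n)
open import Data.Fin using (Fin)
open import Data.Fin.Subset using (Subset; _∈_; _∉_; _⊆_; _⊈_; ∁; Nonempty)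
open import Data.Fin.Subset.Properties using (_∈?_; ∈⊤; x∈p⇒x∉∁p; x∉p⇒x∈∁p)
open import Data.Fin.Properties using (¬∀⟶∃¬; sequence)
open import Data.Product using (_×_; proj₁; proj₂; _,_; ∃)
open import Data.Sum using (_⊎_; inj₁; inj₂)
open import Effect.Monad using (RawMonad)
open import Function using (_∘_)
open import Relation.Nullary using (¬_; Dec; yes; no; contradiction)
open import Relation.Nullary.Decidable using (_→-dec_; decidable-stable)
open import Relation.Nullary.Negation using (¬¬-Monad; ¬¬-map)
open import Relation.Binary.PropositionalEquality as Eq using (_≡_; _≢_; refl; cong)
import Relation.Binary.Reasoning.Setoid as SetoidReasoning

private
  variable
    a b c ℓ : Level
    k : ℕ

module _ {V : Set a} {E : V → V → Set b} where

  walk₀⇒≡ : ∀ {u v} → Walk E u v 0 → u ≡ v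
  walk₀⇒≡ [] = refl

  _∷ʳ_ : ∀ {u v w n} → Walk E u v n → E v w → Walk E u w (suc n)
  [] ∷ʳ e = e ∷ []
  (d ∷ p) ∷ʳ e = d ∷ (p ∷ʳ e)

  reverse : (∀ {u v} → E u v → E v u) → ∀ {u v n} → Walk E u v n → Walk E v u n
  reverse sym [] = []
  reverse sym (e ∷ p) = reverse sym p ∷ʳ sym e

  Dist-sym : (∀ {u v} → E u v → E v u) → ∀ {u v n} → Dist E u v n → Dist E v u n
  Dist-sym sym (p , minimal) = reverse sym p , λ m q → minimal m (reverse sym q)

  edge⇒Dist₁ : ∀ {u v} → u ≢ v → E u v → Dist E u v 1
  edge⇒Dist₁ u≢v e = e ∷ [] , minimal
    where
    minimal : ∀ m → Walk E _ _ m → 1 ≤ m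
    minimal zero p = contradiction (walk₀⇒≡ p) u≢v
    minimal (suc m) _ = s≤s z≤n

  walk₂⇒Dist₂ : ∀ {u v} → u ≢ v → ¬ E u v → Walk E u v 2 → Dist E u v 2
  walk₂⇒Dist₂ u≢v ¬e p = p , minimal
    where
    minimal : ∀ m → Walk E _ _ m → 2 ≤ m
    minimal zero q = contradiction (walk₀⇒≡ q) u≢v
    minimal (suc zero) (e ∷ []) = contradiction e ¬e
    minimal (suc (suc m)) _ = s≤s (s≤s z≤n)

⊈⇒∃∈∉ : {A B : Subset k} → A ⊈ B → ∃ λ i → i ∈ A × i ∉ B
⊈⇒∃∈∉ {k} {A} {B} A⊈B
  with i , ¬[i∈A→i∈B] ← ¬∀⟶∃¬ k _ (λ i → (i ∈? A) →-dec (i ∈? B)) (λ h → A⊈B (h _))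
  = i , decidable-stable (i ∈? A) (λ i∉A → ¬[i∈A→i∈B] (λ i∈A → contradiction i∈A i∉A))
      , (λ i∈B → ¬[i∈A→i∈B] (λ _ → i∈B))

CozeroAdj-sym : (R : CommutativeRing c ℓ) → ∀ {x y} → CozeroAdj R x y → CozeroAdj R y x
CozeroAdj-sym R (x-vertex , y-vertex , x≉y , x∉Ry , y∉Rx) =
  y-vertex , x-vertex , x≉y ∘ CommutativeRing.sym R , y∉Rx , x∉Ry

module Product (F : Fin k → CommutativeRing c ℓ) where
  private
    module F (i : Fin k) = CommutativeRing (F i)
    R = ΠRing F

  ∈R·-preserves-zero : ∀ {x y} i → _∈R·_ R x y → F._≈_ i (y i) (F.0# i) → F._≈_ i (x i) (F.0# i)
  ∈R·-preserves-zero i (r , x≈ry) yᵢ≈0 =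
    F.trans i (x≈ry i) (F.trans i (F.*-congˡ i yᵢ≈0) (F.zeroʳ i (r i)))

  unit-component-≉0 : ∀ {x} i → ¬ F._≈_ i (F.1# i) (F.0# i) → IsUnit R x → ¬ F._≈_ i (x i) (F.0# i)
  unit-component-≉0 i 1≉0 (u , xu≈1) xᵢ≈0 =
    1≉0 (F.trans i (F.sym i (xu≈1 i)) (F.trans i (F.*-congʳ i xᵢ≈0) (F.zeroˡ i (u i))))

  module _ {A : Subset k} {x : ΠCarrier F} (x∈X : InX F A x) where

    InX-∈ : ∀ {i} → i ∈ A → ¬ F._≈_ i (x i) (F.0# i)
    InX-∈ i∈A = proj₂ (x∈X _) i∈A

    InX-∉ : ∀ {i} → i ∉ A → ¬ ¬ F._≈_ i (x i) (F.0# i)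
    InX-∉ i∉A xᵢ≉0 = i∉A (proj₁ (x∈X _) xᵢ≉0)

    InX⇒IsVertex : (∀ i → ¬ F._≈_ i (F.1# i) (F.0# i)) → Nonempty A → (∃ λ j → j ∉ A) →
                   IsVertex R x
    InX⇒IsVertex nontrivial (i , i∈A) (j , j∉A) =
      (λ x≈0 → InX-∈ i∈A (x≈0 i)) ,
      (λ x-unit → InX-∉ j∉A (unit-component-≉0 j (nontrivial j) x-unit))

  InX-∈∉⇒∉R· : ∀ {A B x y i} → InX F A x → InX F B y → i ∈ A → i ∉ B → ¬ _∈R·_ R x y
  InX-∈∉⇒∉R· x∈X y∈X i∈A i∉B x∈Ry =
    InX-∉ y∈X i∉B (InX-∈ x∈X i∈A ∘ ∈R·-preserves-zero _ x∈Ry)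

  InX-⊆⇒¬¬∈R· : (∀ i → IsField (F i)) → ∀ {A B x y} → InX F A x → InX F B y → A ⊆ B →
                ¬ ¬ _∈R·_ R x y
  InX-⊆⇒¬¬∈R· fields {A} {B} {x} {y} x∈X y∈X A⊆B =
    ¬¬-map (λ x≈ry → (λ i → quotient i (i ∈? B)) , x≈ry)
      (sequence (RawMonad.rawApplicative ¬¬-Monad) (λ i → quotient-spec i (i ∈? B)))
    where
    inverse : ∀ {i} → i ∈ B → ∃ λ v → F._≈_ i (F._*_ i (y i) v) (F.1# i)
    inverse {i} i∈B = proj₂ (fields i) (y i) (InX-∈ y∈X i∈B)

    quotient : ∀ i → Dec (i ∈ B) → F.Carrier i
    quotient i (yes i∈B) = F._*_ i (x i) (proj₁ (inverse i∈B))
    quotient i (no _) = F.0# i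

    quotient-spec : ∀ i d → ¬ ¬ F._≈_ i (x i) (F._*_ i (quotient i d) (y i))
    quotient-spec i (yes i∈B) ¬x≈ry = ¬x≈ry (F.sym i (begin
        (x i * v) * y i  ≈⟨ F.*-assoc i (x i) v (y i) ⟩
        x i * (v * y i)  ≈⟨ F.*-congˡ i (F.*-comm i v (y i)) ⟩
        x i * (y i * v)  ≈⟨ F.*-congˡ i yv≈1 ⟩
        x i * F.1# i     ≈⟨ F.*-identityʳ i (x i) ⟩
        x i              ∎))
      where
      open F i using (_*_)
      open SetoidReasoning (F.setoid i)
      v = proj₁ (inverse i∈B)
      yv≈1 = proj₂ (inverse i∈B)
    quotient-spec i (no i∉B) ¬x≈ry = InX-∉ x∈X (i∉B ∘ A⊆B)
      (λ xᵢ≈0 → ¬x≈ry (F.trans i xᵢ≈0 (F.sym i (F.zeroˡ i (y i)))))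

module Representatives (F : Fin k → CommutativeRing c ℓ) (fields : ∀ i → IsField (F i))
    (rep : NEPSubset k → ΠCarrier F) (rep∈X : ∀ A → InX F (proj₁ A) (rep A)) where
  open Product F

  private
    E = UpsilonAdj F rep

  vertex : ∀ A → IsVertex (ΠRing F) (rep A)
  vertex (A , nonempty , _ , outside) =
    InX⇒IsVertex (rep∈X _) (proj₁ ∘ fields) nonempty (proj₁ outside , proj₂ (proj₂ outside))

  adjacent : ∀ {A B i j} → i ∈ proj₁ A → i ∉ proj₁ B → j ∈ proj₁ B → j ∉ proj₁ A → E A B
  adjacent {A} {B} i∈A i∉B j∈B j∉A =
    vertex A , vertex B ,
    (λ x≈y → InX-∉ (rep∈X B) i∉B (InX-∈ (rep∈X A) i∈A ∘ CommutativeRing.trans (F _) (x≈y _))) ,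
    InX-∈∉⇒∉R· (rep∈X A) (rep∈X B) i∈A i∉B ,
    InX-∈∉⇒∉R· (rep∈X B) (rep∈X A) j∈B j∉A

  incomparable⇒adjacent : ∀ {A B} → proj₁ A ⊈ proj₁ B → proj₁ B ⊈ proj₁ A → E A B
  incomparable⇒adjacent A⊈B B⊈A
    with _ , i∈A , i∉B ← ⊈⇒∃∈∉ A⊈B | _ , j∈B , j∉A ← ⊈⇒∃∈∉ B⊈A
    = adjacent i∈A i∉B j∈B j∉A

  ⊆⇒¬adjacent : ∀ {A B} → proj₁ A ⊆ proj₁ B → ¬ E A B
  ⊆⇒¬adjacent {A} {B} A⊆B (_ , _ , _ , x∉Ry , _) =
    InX-⊆⇒¬¬∈R· fields (rep∈X A) (rep∈X B) A⊆B x∉Ry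

  complement : NEPSubset k → NEPSubset k
  complement (A , (i , i∈A) , _ , j , _ , j∉A) =
    ∁ A , (j , x∉p⇒x∈∁p j∉A) , (λ _ → ∈⊤) , i , ∈⊤ , x∈p⇒x∉∁p i∈A

  ⊆⇒walk₂ : ∀ {A B} → proj₁ A ⊆ proj₁ B → Walk E A B 2
  ⊆⇒walk₂ {A@(_ , (i , i∈A) , _ , j , _ , j∉A)} {B@(_ , _ , _ , l , _ , l∉B)} A⊆B =
    adjacent {A} {complement A} i∈A (x∈p⇒x∉∁p i∈A) (x∉p⇒x∈∁p j∉A) j∉A ∷
    (adjacent {complement A} {B} (x∉p⇒x∈∁p (l∉B ∘ A⊆B)) l∉B (A⊆B i∈A) (x∈p⇒x∉∁p i∈A) ∷ [])

  ⊆⇒Dist₂ : ∀ {A B} → proj₁ A ≢ proj₁ B → proj₁ A ⊆ proj₁ B → Dist E A B 2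
  ⊆⇒Dist₂ A≢B A⊆B = walk₂⇒Dist₂ (A≢B ∘ cong proj₁) (⊆⇒¬adjacent A⊆B) (⊆⇒walk₂ A⊆B)

lemma4p1 : {c ℓ : Level} (k : ℕ) → 2 ≤ k →
    (F : Fin k → CommutativeRing c ℓ) →
    (∀ i → IsField (F i)) → (∀ i → IsFinite (F i)) →
    (rep : NEPSubset k → ΠCarrier F) →
    (∀ A → InX F (proj₁ A) (rep A)) →
    (A B : NEPSubset k) → proj₁ A ≢ proj₁ B →
    ((¬ (proj₁ A ⊆ proj₁ B)) × (¬ (proj₁ B ⊆ proj₁ A)) → Dist (UpsilonAdj F rep) A B 1)
    × ((proj₁ A ⊆ proj₁ B) ⊎ (proj₁ B ⊆ proj₁ A) → Dist (UpsilonAdj F rep) A B 2)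
lemma4p1 k _ F fields _ rep rep∈X A B A≢B = incomparable , comparable
  where
  open Representatives F fields rep rep∈X

  incomparable : proj₁ A ⊈ proj₁ B × proj₁ B ⊈ proj₁ A → Dist (UpsilonAdj F rep) A B 1
  incomparable (A⊈B , B⊈A) = edge⇒Dist₁ (A≢B ∘ cong proj₁) (incomparable⇒adjacent A⊈B B⊈A)

  comparable : proj₁ A ⊆ proj₁ B ⊎ proj₁ B ⊆ proj₁ A → Dist (UpsilonAdj F rep) A B 2
  comparable (inj₁ A⊆B) = ⊆⇒Dist₂ A≢B A⊆B
  comparable (inj₂ B⊆A) = Dist-sym (CozeroAdj-sym (ΠRing F)) (⊆⇒Dist₂ (A≢B ∘ Eq.sym) B⊆A)
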